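{- In the setting described in the context, for all $u\in V$, $|H_u| \leq 3 n /\mathcal{D}$.
   Context: $G=(V,E)$ is a connected unweighted undirected graph with $n=|V|$ nodes and distance $d$. Fix an integer $\mathcal{D}>0$ with $12\mid\mathcal{D}$. For each pair of nodes $u,v$ a shortest path $P(u,v)$ is fixed, with ties broken consistently so that $P(u,v)=P(v,u)$ and, for each $u$, $\bigcup_{v\in V}P(u,v)$ is a spanning tree of $G$. For $u\in V$, $T_u:=\bigcup_{v\in V: d(u,v)\in[\mathcal{D},5\mathcal{D}/4]}P(u,v)$, a tree rooted at $u$, and $T_u^*$ is the subtree of $T_u$ induced by its nodes at distance at most $3\mathcal{D}/4$ from $u$. $H_u$ is the set of nodes $w$ of $T_u^*$ such that the subtree of $T_u^*$ rooted at $w$ has at least $\mathcal{D}$ leaves. -}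

module Defs where

open import Data.Nat using (ℕ; zero; suc; _+_; _*_; _∸_; _≤_; _<_)
open import Data.Nat.Divisibility using (_∣_)
open import Data.Nat.DivMod using (_/_)
open import Data.Fin using (Fin)
open import Data.List using (List; []; _∷_; length; reverse)
open import Data.List.Membership.Propositional using (_∈_)
open import Data.List.Relation.Unary.All using (All)
open import Data.List.Relation.Unary.Unique.Propositional using (Unique)
open import Data.Product using (Σ; ∃; _×_; _,_)
open import Data.Sum using (_⊎_)
open import Relation.Binary.PropositionalEquality using (_≡_; _≢_)
open import Relation.Nullary using (¬_)

data Walk {V : Set} (E : V → V → Set) : V → V → List V → Set where
  nil  : ∀ {x} → Walk E x x (x ∷ [])
  cons : ∀ {x y z ys} → E x y → Walk E y z ys → Walk E x z (x ∷ ys)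

data Consec {V : Set} : List V → V → V → Set where
  here  : ∀ {x y xs} → Consec (x ∷ y ∷ xs) x y
  there : ∀ {z x y xs} → Consec xs x y → Consec (z ∷ xs) x y

PathEdge : {V : Set} → List V → V → V → Set
PathEdge p x y = Consec p x y ⊎ Consec p y x

IsSpanningTree : {V : Set} → (V → V → Set) → Set
IsSpanningTree {V} F =
  (∀ (x y : V) → ∃ λ ps → Walk F x y ps) ×
  (∀ (x y : V) (ps qs : List V) →
     Walk F x y ps → Unique ps → Walk F x y qs → Unique qs → ps ≡ qs)

record Setting (n : ℕ) : Set₁ where
  field
    Adj     : Fin n → Fin n → Set
    adj-sym : ∀ {x y} → Adj x y → Adj y x
    -- d is the graph distance (length of a shortest walk, in edges);
    -- in particular G is connected
    d       : Fin n → Fin n → ℕ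
    d-walk  : ∀ u v → ∃ λ ps → Walk Adj u v ps × length ps ≡ suc (d u v)
    d-min   : ∀ u v ps → Walk Adj u v ps → suc (d u v) ≤ length ps
    𝒟       : ℕ
    𝒟-pos   : 0 < 𝒟
    12∣𝒟    : 12 ∣ 𝒟
    P       : Fin n → Fin n → List (Fin n)
    P-walk  : ∀ u v → Walk Adj u v (P u v)
    P-short : ∀ u v → length (P u v) ≡ suc (d u v)
    P-sym   : ∀ u v → P v u ≡ reverse (P u v)
    P-tree  : ∀ u → IsSpanningTree (λ x y → ∃ λ v → PathEdge (P u v) x y)

module _ {n : ℕ} (S : Setting n) where
  open Setting S

  V : Set
  V = Fin n

  Target : V → V → Set
  Target u v = 𝒟 ≤ d u v × d u v ≤ 5 * (𝒟 / 4)

  TNode : V → V → Set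
  TNode u x = ∃ λ v → Target u v × x ∈ P u v

  TEdge : V → V → V → Set
  TEdge u x y = ∃ λ v → Target u v × PathEdge (P u v) x y

  T*Node : V → V → Set
  T*Node u x = TNode u x × d u x ≤ 3 * (𝒟 / 4)

  T*Edge : V → V → V → Set
  T*Edge u x y = TEdge u x y × T*Node u x × T*Node u y

  -- x lies in the subtree of T*_u (rooted at u) rooted at w, i.e. w is
  -- an ancestor of x: x is a node of T*_u and every walk in T*_u from
  -- the root u to x passes through w.
  InSubtree : V → V → V → Set
  InSubtree u w x = T*Node u x × (∀ ps → Walk (T*Edge u) u x ps → w ∈ ps)

  Leaf : V → V → V → Set
  Leaf u w x = InSubtree u w x ×
    ¬ (∃ λ y → T*Edge u x y × y ≢ x × InSubtree u x y)

  H : V → V → Set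
  H u w = T*Node u w ×
    ∃ λ ls → Unique ls × All (Leaf u w) ls × 𝒟 ≤ length ls

-- Distances from u increase by exactly one along every P(u,v), so every
-- node of T*_u sits at depth d(u,·) on some P(u,v), and a leaf x of T*_u
-- has depth exactly 3𝒟/4: otherwise the next node of a path P(u,v) through
-- x would be a child of x.  Charge a pair (w , x), with w ∈ H_u and x a leaf
-- below w, to the node y at depth 3𝒟/4 + ⌊d(u,w)/3⌋ ≤ 𝒟 on such a path,
-- together with d(u,w) mod 3.  Since ⋃_v P(u,v) is a tree, y determines the
-- path from u to y, which contains x and w; so this is an injection of the
-- at least |H_u|·𝒟 pairs into V × {0,1,2}.
module Submission where

open import Defs
open import Data.Empty using (⊥-elim)
open import Data.Fin using (Fin; toℕ; combine)
import Data.Fin as Fin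
open import Data.Fin.Properties using (combine-injective; injective⇒≤)
open import Data.List using (List; []; _∷_; length; take; map; _++_; lookup)
open import Data.List.Properties using (length-++; length-map)
open import Data.List.Membership.Propositional using (_∈_)
open import Data.List.Membership.Propositional.Properties using (∈-lookup; ∈-map⁻; ∈-++⁻)
open import Data.List.Relation.Binary.Subset.Propositional using (_⊆_)
open import Data.List.Relation.Binary.Sublist.Propositional using ()
  renaming (lookup to Sublist-lookup)
open import Data.List.Relation.Binary.Sublist.Propositional.Properties using (take-⊆)
open import Data.List.Relation.Unary.All as All using (All; []; _∷_)
import Data.List.Relation.Unary.All.Properties as All
open import Data.List.Relation.Unary.Any using (here; there)
open import Data.List.Relation.Unary.Unique.Propositional using (Unique; []; _∷_)
import Data.List.Relation.Unary.Unique.Propositional.Properties as Unique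
open import Data.Nat using (ℕ; zero; suc; _+_; _*_; _≤_; _<_; z≤n; s≤s; s≤s⁻¹; _/_; NonZero)
open import Data.Nat.DivMod using (_mod_; _divMod_; DivMod; m*n/n≡m; m*[n/m]≡n; /-monoˡ-≤)
open import Data.Nat.Divisibility using (∣-trans; divides)
open import Data.Nat.Properties
open import Data.Product using (∃; _×_; _,_; proj₁; proj₂; uncurry)
open import Data.Product.Properties using (,-injectiveʳ)
open import Data.Sum using (inj₁; inj₂)
open import Relation.Binary.Definitions using (DecidableEquality)
open import Relation.Binary.PropositionalEquality
open import Relation.Nullary using (¬_; yes; no)

lookupOr : {A : Set} → A → List A → ℕ → A
lookupOr a []       i       = a
lookupOr a (x ∷ xs) zero    = x
lookupOr a (x ∷ xs) (suc i) = lookupOr a xs i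

module _ {A : Set} where

  lookupOr-∈ : ∀ (a : A) xs {i} → i < length xs → lookupOr a xs i ∈ xs
  lookupOr-∈ a (x ∷ xs) {zero}  _       = here refl
  lookupOr-∈ a (x ∷ xs) {suc i} (s≤s i<) = there (lookupOr-∈ a xs i<)

  lookupOr-∈-take : ∀ (a : A) xs {i m} → i < m → i < length xs → lookupOr a xs i ∈ take m xs
  lookupOr-∈-take a (x ∷ xs) {zero}  {suc m} _        _        = here refl
  lookupOr-∈-take a (x ∷ xs) {suc i} {suc m} (s≤s i<m) (s≤s i<) = there (lookupOr-∈-take a xs i<m i<)

  Consec-lookupOr : ∀ (a : A) xs {i} → suc i < length xs →
                    Consec xs (lookupOr a xs i) (lookupOr a xs (suc i))
  Consec-lookupOr a (x ∷ [])    {zero}  (s≤s ())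
  Consec-lookupOr a (x ∷ y ∷ xs) {zero}  _        = here
  Consec-lookupOr a (x ∷ y ∷ xs) {suc i} (s≤s i<) = there (Consec-lookupOr a (y ∷ xs) i<)

  Unique-lookup-injective : ∀ {xs : List A} → Unique xs → ∀ {i j} → lookup xs i ≡ lookup xs j → i ≡ j
  Unique-lookup-injective (x∉ ∷ _) {Fin.zero}  {Fin.zero}  _  = refl
  Unique-lookup-injective (x∉ ∷ _) {Fin.zero}  {Fin.suc j} eq = ⊥-elim (All.lookup x∉ (∈-lookup j) eq)
  Unique-lookup-injective (x∉ ∷ _) {Fin.suc i} {Fin.zero}  eq = ⊥-elim (All.lookup x∉ (∈-lookup i) (sym eq))
  Unique-lookup-injective (_ ∷ u)  {Fin.suc i} {Fin.suc j} eq = cong Fin.suc (Unique-lookup-injective u eq)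

  Unique-length-≤ : ∀ {m} {xs : List A} → Unique xs → (f : ∀ {x} → x ∈ xs → Fin m) →
                    (∀ {x y} (p : x ∈ xs) (q : y ∈ xs) → f p ≡ f q → x ≡ y) → length xs ≤ m
  Unique-length-≤ u f f-inj =
    injective⇒≤ (λ eq → Unique-lookup-injective u (f-inj (∈-lookup _) (∈-lookup _) eq))

module _ {A B : Set} {Q : A → Set} (fibre : ∀ {a} → Q a → List B) where

  fibrePairs : ∀ {as} → All Q as → List (A × B)
  fibrePairs []               = []
  fibrePairs {a ∷ _} (q ∷ qs) = map (a ,_) (fibre q) ++ fibrePairs qs

  fibrePairs-length : ∀ {as k} (qs : All Q as) → (∀ {a} (q : Q a) → k ≤ length (fibre q)) →
                      length as * k ≤ length (fibrePairs qs)
  fibrePairs-length []                     _    = z≤n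
  fibrePairs-length {a ∷ as} {k} (q ∷ qs) long = begin
    k + length as * k                                      ≤⟨ +-mono-≤ (long q) (fibrePairs-length qs long) ⟩
    length (fibre q) + length (fibrePairs qs)              ≡⟨ cong (_+ _) (length-map (a ,_) (fibre q)) ⟨
    length (map (a ,_) (fibre q)) + length (fibrePairs qs) ≡⟨ length-++ (map (a ,_) (fibre q)) ⟨
    length (fibrePairs (q ∷ qs))                           ∎
    where open ≤-Reasoning

  fibrePairs-All : ∀ {R : A → B → Set} {as} (qs : All Q as) →
                   (∀ {a} (q : Q a) → All (R a) (fibre q)) → All (uncurry R) (fibrePairs qs)
  fibrePairs-All []       _   = []
  fibrePairs-All (q ∷ qs) all = All.++⁺ (All.map⁺ (all q)) (fibrePairs-All qs all)

  ∈-fibrePairs : ∀ {as p} (qs : All Q as) → p ∈ fibrePairs qs → proj₁ p ∈ as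
  ∈-fibrePairs {a ∷ _} (q ∷ qs) p∈ with ∈-++⁻ (map (a ,_) (fibre q)) p∈
  ... | inj₁ p∈fibre with ∈-map⁻ (a ,_) p∈fibre
  ...   | _ , _ , refl = here refl
  ∈-fibrePairs (q ∷ qs) p∈ | inj₂ p∈rest = there (∈-fibrePairs qs p∈rest)

  fibrePairs-unique : ∀ {as} (qs : All Q as) → Unique as → (∀ {a} (q : Q a) → Unique (fibre q)) →
                      Unique (fibrePairs qs)
  fibrePairs-unique []               _          _   = []
  fibrePairs-unique {a ∷ _} (q ∷ qs) (a∉ ∷ as!) uni =
    Unique.++⁺ (Unique.map⁺ ,-injectiveʳ (uni q)) (fibrePairs-unique qs as! uni) disjoint
    where
      disjoint : ∀ {p} → ¬ (p ∈ map (a ,_) (fibre q) × p ∈ fibrePairs qs)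
      disjoint (p∈ , p∈′) with ∈-map⁻ (a ,_) p∈
      ... | _ , _ , refl = All.lookup a∉ (∈-fibrePairs qs p∈′) refl

div-mod-injective : ∀ {m m′} k .{{_ : NonZero k}} → m / k ≡ m′ / k → m mod k ≡ m′ mod k → m ≡ m′
div-mod-injective {m} {m′} k q≡ r≡ = begin
  m                           ≡⟨ DivMod.property (m divMod k) ⟩
  toℕ (m mod k) + m / k * k   ≡⟨ cong₂ (λ r t → toℕ r + t * k) r≡ q≡ ⟩
  toℕ (m′ mod k) + m′ / k * k ≡⟨ DivMod.property (m′ divMod k) ⟨
  m′                          ∎
  where open ≡-Reasoning

module _ {A : Set} where

  Walk-head∈ : ∀ {R : A → A → Set} {x z xs} → Walk R x z xs → x ∈ xs
  Walk-head∈ nil        = here refl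
  Walk-head∈ (cons _ _) = here refl

  Walk-map∈ : ∀ {R R′ : A → A → Set} {x z xs} → (∀ {a b} → a ∈ xs → b ∈ xs → R a b → R′ a b) →
              Walk R x z xs → Walk R′ x z xs
  Walk-map∈ f nil        = nil
  Walk-map∈ f (cons e w) =
    cons (f (here refl) (there (Walk-head∈ w)) e) (Walk-map∈ (λ a∈ b∈ → f (there a∈) (there b∈)) w)

  Walk-map : ∀ {R R′ : A → A → Set} {x z xs} → (∀ {a b} → R a b → R′ a b) →
             Walk R x z xs → Walk R′ x z xs
  Walk-map f = Walk-map∈ (λ _ _ → f)

  Walk-++ : ∀ {R : A → A → Set} {x y z xs ys} → Walk R x y xs → Walk R y z ys →
            ∃ λ zs → Walk R x z zs × suc (length zs) ≡ length xs + length ys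
  Walk-++ nil         w = _ , w , refl
  Walk-++ (cons e w₁) w₂ with Walk-++ w₁ w₂
  ... | zs , w , ∣zs∣ = _ , cons e w , cong suc ∣zs∣

  Walk-Consec-head : ∀ {R : A → A → Set} {x y z ys} → Walk R y z ys → Consec (x ∷ ys) x y
  Walk-Consec-head nil        = here
  Walk-Consec-head (cons _ _) = here

  Walk-take : ∀ {R : A → A → Set} {x z xs} (a : A) → Walk R x z xs → ∀ {i} → i < length xs →
              Walk (Consec xs) x (lookupOr a xs i) (take (suc i) xs)
  Walk-take a nil        {zero}  _        = nil
  Walk-take a nil        {suc i} (s≤s ())
  Walk-take a (cons e w) {zero}  _        = nil
  Walk-take a (cons e w) {suc i} (s≤s i<) = cons (Walk-Consec-head w) (Walk-map there (Walk-take a w i<))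

  module _ (_≟_ : DecidableEquality A) where
    open import Data.List.Membership.DecPropositional _≟_ using (_∈?_)

    Walk-suffix : ∀ {R : A → A → Set} {x y z ys} → Walk R y z ys → Unique ys → x ∈ ys →
                  ∃ λ zs → Walk R x z zs × Unique zs × zs ⊆ ys
    Walk-suffix w@nil        ys! (here refl) = _ , w , ys! , λ z∈ → z∈
    Walk-suffix w@(cons _ _) ys! (here refl) = _ , w , ys! , λ z∈ → z∈
    Walk-suffix (cons e w) (_ ∷ ys!) (there x∈) with Walk-suffix w ys! x∈
    ... | zs , w′ , zs! , zs⊆ = zs , w′ , zs! , λ z∈ → there (zs⊆ z∈)

    Walk-simplify : ∀ {R : A → A → Set} {x z xs} → Walk R x z xs →
                    ∃ λ ys → Walk R x z ys × Unique ys × ys ⊆ xs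
    Walk-simplify nil = _ , nil , [] ∷ [] , λ z∈ → z∈
    Walk-simplify {x = x} (cons e w) with Walk-simplify w
    ... | ys , w′ , ys! , ys⊆ with x ∈? ys
    ...   | yes x∈ with Walk-suffix w′ ys! x∈
    ...     | zs , w″ , zs! , zs⊆ = zs , w″ , zs! , λ z∈ → there (ys⊆ (zs⊆ z∈))
    Walk-simplify {x = x} (cons e w) | ys , w′ , ys! , ys⊆ | no x∉ =
      x ∷ ys , cons e w′ , All.tabulate (λ y∈ x≡y → x∉ (subst (_∈ ys) (sym x≡y) y∈)) ∷ ys! ,
      λ { (here z≡x) → here z≡x ; (there z∈) → there (ys⊆ z∈) }

data Graded {A : Set} (δ : A → ℕ) : ℕ → List A → Set where
  []  : ∀ {k} → Graded δ k []
  _∷_ : ∀ {k x xs} → δ x ≡ k → Graded δ (suc k) xs → Graded δ k (x ∷ xs)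

module _ {A : Set} {δ : A → ℕ} where

  Graded-≥ : ∀ {k xs x} → Graded δ k xs → x ∈ xs → k ≤ δ x
  Graded-≥ (δx ∷ g) (here refl) = ≤-reflexive (sym δx)
  Graded-≥ (δx ∷ g) (there x∈)  = ≤-trans (n≤1+n _) (Graded-≥ g x∈)

  Graded-unique : ∀ {k xs} → Graded δ k xs → Unique xs
  Graded-unique []       = []
  Graded-unique (δx ∷ g) =
    All.tabulate (λ y∈ x≡y → 1+n≰n (≤-trans (Graded-≥ g y∈) (≤-reflexive (trans (cong δ (sym x≡y)) δx))))
    ∷ Graded-unique g

  Graded-take-< : ∀ {k xs x} m → Graded δ k xs → x ∈ take m xs → δ x < k + m
  Graded-take-< {k} (suc m) (δx ∷ g) (here refl) =
    ≤-trans (s≤s (≤-trans (≤-reflexive δx) (m≤m+n k m))) (≤-reflexive (sym (+-suc k m)))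
  Graded-take-< {k} (suc m) (δx ∷ g) (there x∈)  =
    ≤-trans (Graded-take-< m g x∈) (≤-reflexive (sym (+-suc k m)))

  Graded-δ-lookupOr : ∀ {k xs} (a : A) → Graded δ k xs → ∀ {j} → j < length xs →
                      δ (lookupOr a xs j) ≡ k + j
  Graded-δ-lookupOr {k} a (δx ∷ g) {zero}  _        = trans δx (sym (+-identityʳ k))
  Graded-δ-lookupOr {k} a (δx ∷ g) {suc j} (s≤s j<) = trans (Graded-δ-lookupOr a g j<) (sym (+-suc k j))

  Graded-lookupOr : ∀ {k xs x} (a : A) → Graded δ k xs → x ∈ xs → ∀ j → δ x ≡ k + j →
                    x ≡ lookupOr a xs j
  Graded-lookupOr a (δx ∷ g) (here refl) zero _ = refl
  Graded-lookupOr {k} a (δx ∷ g) (here refl) (suc j) δx≡ =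
    ⊥-elim (m≢1+m+n k (trans (sym δx) (trans δx≡ (+-suc k j))))
  Graded-lookupOr {k} a (δx ∷ g) (there x∈) zero    δx≡ =
    ⊥-elim (1+n≰n (≤-trans (Graded-≥ g x∈) (≤-reflexive (trans δx≡ (+-identityʳ k)))))
  Graded-lookupOr {k} a (δx ∷ g) (there x∈) (suc j) δx≡ =
    Graded-lookupOr a g x∈ j (trans δx≡ (+-suc k j))

module _ {n : ℕ} (S : Setting n) where
  open Setting S

  d-triangle : ∀ x y z → d x z ≤ d x y + d y z
  d-triangle x y z with d-walk x y | d-walk y z
  ... | _ , w₁ , ∣w₁∣ | _ , w₂ , ∣w₂∣ with Walk-++ w₁ w₂
  ... | zs , w , ∣zs∣ = s≤s⁻¹ (begin
    suc (d x z)         ≤⟨ d-min x z zs w ⟩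
    length zs           ≡⟨ suc-injective (trans ∣zs∣ (cong₂ _+_ ∣w₁∣ ∣w₂∣)) ⟩
    d x y + suc (d y z) ≡⟨ +-suc (d x y) (d y z) ⟩
    suc (d x y + d y z) ∎)
    where open ≤-Reasoning

  d-adj : ∀ x {a b} → Adj a b → d x b ≤ suc (d x a)
  d-adj x {a} {b} e = begin
    d x b         ≤⟨ d-triangle x a b ⟩
    d x a + d a b ≤⟨ +-monoʳ-≤ (d x a) (s≤s⁻¹ (d-min a b _ (cons e nil))) ⟩
    d x a + 1     ≡⟨ +-comm (d x a) 1 ⟩
    suc (d x a)   ∎
    where open ≤-Reasoning

  d-self : ∀ x → d x x ≡ 0
  d-self x = n≤0⇒n≡0 (s≤s⁻¹ (d-min x x _ nil))

  geodesic-graded : ∀ x {a z ys} k → Walk Adj a z ys → d x a ≡ k → k + length ys ≡ suc (d x z) →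
                    Graded (d x) k ys
  geodesic-graded x k nil dxa _ = dxa ∷ []
  geodesic-graded x {z = z} k (cons {y = b} {ys = ys} e w) dxa ∣w∣ =
    dxa ∷ geodesic-graded x (suc k) w dxb (trans (sym (+-suc k (length ys))) ∣w∣)
    where
      open ≤-Reasoning
      dxb : d x b ≡ suc k
      dxb = ≤-antisym (subst (d x b ≤_) (cong suc dxa) (d-adj x e))
        (+-cancelʳ-≤ (d b z) (suc k) (d x b) (begin
          suc k + d b z   ≡⟨ +-suc k (d b z) ⟨
          k + suc (d b z) ≤⟨ +-monoʳ-≤ k (d-min b z ys w) ⟩
          k + length ys   ≡⟨ suc-injective (trans (sym (+-suc k (length ys))) ∣w∣) ⟩
          d x z           ≤⟨ d-triangle x b z ⟩
          d x b + d b z   ∎))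

  P-graded : ∀ u v → Graded (d u) 0 (P u v)
  P-graded u v = geodesic-graded u 0 (P-walk u v) (d-self u) (P-short u v)

  module _ (u : Fin n) where

    vertexAt : Fin n → ℕ → Fin n
    vertexAt v = lookupOr u (P u v)

    prefix : Fin n → ℕ → List (Fin n)
    prefix v i = take (suc i) (P u v)

    d-vertexAt : ∀ v {i} → i < length (P u v) → d u (vertexAt v i) ≡ i
    d-vertexAt v = Graded-δ-lookupOr u (P-graded u v)

    ∈P⇒vertexAt : ∀ v {x} → x ∈ P u v → x ≡ vertexAt v (d u x)
    ∈P⇒vertexAt v {x} x∈ = Graded-lookupOr u (P-graded u v) x∈ (d u x) refl

    ∈prefix⇒∈P : ∀ v i {x} → x ∈ prefix v i → x ∈ P u v
    ∈prefix⇒∈P v i = Sublist-lookup (take-⊆ (suc i) (P u v))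

    ∈prefix⇒d≤ : ∀ v i {x} → x ∈ prefix v i → d u x ≤ i
    ∈prefix⇒d≤ v i x∈ = s≤s⁻¹ (Graded-take-< (suc i) (P-graded u v) x∈)

    vertexAt-∈-prefix : ∀ v {i j} → j ≤ i → i < length (P u v) → vertexAt v j ∈ prefix v i
    vertexAt-∈-prefix v j≤i i< = lookupOr-∈-take u (P u v) (s≤s j≤i) (≤-<-trans j≤i i<)

    prefix-unique : ∀ v i → Unique (prefix v i)
    prefix-unique v i = Unique.take⁺ (suc i) (Graded-unique (P-graded u v))

    TreeEdge : Fin n → Fin n → Set
    TreeEdge x y = ∃ λ v → PathEdge (P u v) x y

    tree-path-unique : ∀ {y xs ys} → Walk TreeEdge u y xs → Unique xs → Walk TreeEdge u y ys → Unique ys →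
                       xs ≡ ys
    tree-path-unique = proj₂ (P-tree u) u _ _ _

    prefix-tree-walk : ∀ v {i} → i < length (P u v) → Walk TreeEdge u (vertexAt v i) (prefix v i)
    prefix-tree-walk v i< = Walk-map (λ c → v , inj₁ c) (Walk-take u (P-walk u v) i<)

    vertexAt-agree : ∀ v v′ {i j} → i < length (P u v) → i < length (P u v′) →
                     vertexAt v i ≡ vertexAt v′ i → j ≤ i → vertexAt v j ≡ vertexAt v′ j
    vertexAt-agree v v′ {i} {j} i< i<′ same j≤i = begin
      vertexAt v j                     ≡⟨ ∈P⇒vertexAt v′ (∈prefix⇒∈P v′ i vertex∈) ⟩
      vertexAt v′ (d u (vertexAt v j)) ≡⟨ cong (vertexAt v′) (d-vertexAt v (≤-<-trans j≤i i<)) ⟩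
      vertexAt v′ j                    ∎
      where
        open ≡-Reasoning
        prefix≡ : prefix v i ≡ prefix v′ i
        prefix≡ = tree-path-unique (prefix-tree-walk v i<) (prefix-unique v i)
          (subst (λ y → Walk TreeEdge u y (prefix v′ i)) (sym same) (prefix-tree-walk v′ i<′))
          (prefix-unique v′ i)
        vertex∈ : vertexAt v j ∈ prefix v′ i
        vertex∈ = subst (vertexAt v j ∈_) prefix≡ (vertexAt-∈-prefix v j≤i i<)

    quarter : ℕ
    quarter = 𝒟 / 4

    3q≤4q : 3 * quarter ≤ 4 * quarter
    3q≤4q = *-monoˡ-≤ quarter (n≤1+n 3)

    target-index-< : ∀ {v i} → Target S u v → i ≤ 4 * quarter → i < length (P u v)
    target-index-< {v} {i} (𝒟≤ , _) i≤ = begin-strict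
      i              ≤⟨ i≤ ⟩
      4 * quarter    ≡⟨ m*[n/m]≡n (∣-trans (divides 3 refl) 12∣𝒟) ⟩
      𝒟              ≤⟨ 𝒟≤ ⟩
      d u v          <⟨ n<1+n (d u v) ⟩
      suc (d u v)    ≡⟨ P-short u v ⟨
      length (P u v) ∎
      where open ≤-Reasoning

    prefix-T*-walk : ∀ {v i} → Target S u v → i ≤ 3 * quarter → i < length (P u v) →
                     Walk (T*Edge S u) u (vertexAt v i) (prefix v i)
    prefix-T*-walk {v} {i} t i≤ i< =
      Walk-map∈ (λ a∈ b∈ c → (v , t , inj₁ c) , node a∈ , node b∈) (Walk-take u (P-walk u v) i<)
      where
        node : ∀ {x} → x ∈ prefix v i → T*Node S u x
        node x∈ = (v , t , ∈prefix⇒∈P v i x∈) , ≤-trans (∈prefix⇒d≤ v i x∈) i≤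

    T*-walk-through-prefix : ∀ v {i j ys} → i < length (P u v) → j ≤ i →
                             Walk (T*Edge S u) u (vertexAt v i) ys → vertexAt v j ∈ ys
    T*-walk-through-prefix v {i} {j} i< j≤i w with Walk-simplify Fin._≟_ w
    ... | zs , w′ , zs! , zs⊆ = zs⊆ (subst (vertexAt v j ∈_) (sym zs≡) (vertexAt-∈-prefix v j≤i i<))
      where
        zs≡ : zs ≡ prefix v i
        zs≡ = tree-path-unique (Walk-map (λ ((v′ , _ , e) , _) → v′ , e) w′) zs!
                (prefix-tree-walk v i<) (prefix-unique v i)

    leaf-depth : ∀ {v h x} → Target S u v → x ∈ P u v → Leaf S u h x → d u x ≡ 3 * quarter
    leaf-depth {v} {x = x} t x∈ (((x-node , dx≤) , _) , childless) with m≤n⇒m<n∨m≡n dx≤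
    ... | inj₂ dx≡ = dx≡
    ... | inj₁ dx< = ⊥-elim (childless (y , edge , y≢x , y-below-x))
      where
        j : ℕ
        j = d u x
        x≡ : x ≡ vertexAt v j
        x≡ = ∈P⇒vertexAt v x∈
        sj< : suc j < length (P u v)
        sj< = target-index-< t (≤-trans dx< 3q≤4q)
        y : Fin n
        y = vertexAt v (suc j)
        dy : d u y ≡ suc j
        dy = d-vertexAt v sj<
        y-node : T*Node S u y
        y-node = (v , t , lookupOr-∈ u (P u v) sj<) , subst (_≤ 3 * quarter) (sym dy) dx<
        edge : T*Edge S u x y
        edge = (v , t , inj₁ (subst (λ z → Consec (P u v) z y) (sym x≡) (Consec-lookupOr u (P u v) sj<)))
             , (x-node , dx≤) , y-node
        y≢x : y ≢ x
        y≢x y≡x = 1+n≰n (≤-reflexive (trans (sym dy) (cong (d u) y≡x)))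
        y-below-x : InSubtree S u x y
        y-below-x = y-node , λ ys w → subst (_∈ ys) (sym x≡) (T*-walk-through-prefix v sj< (n≤1+n j) w)

    record LeafAnchor (h x : Fin n) : Set where
      field
        branch         : Fin n
        branch-target  : Target S u branch
        ancestor-depth : d u h ≤ 3 * quarter
        ancestor-at    : h ≡ vertexAt branch (d u h)
        leaf-at        : x ≡ vertexAt branch (3 * quarter)

    leaf-anchor : ∀ {h x} → Leaf S u h x → LeafAnchor h x
    leaf-anchor {h} {x} lf@((((v , t , x∈) , _) , through) , _) = record
      { branch         = v
      ; branch-target  = t
      ; ancestor-depth = ∈prefix⇒d≤ v (3 * quarter) h∈
      ; ancestor-at    = ∈P⇒vertexAt v (∈prefix⇒∈P v (3 * quarter) h∈)
      ; leaf-at        = x≡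
      }
      where
        x≡ : x ≡ vertexAt v (3 * quarter)
        x≡ = trans (∈P⇒vertexAt v x∈) (cong (vertexAt v) (leaf-depth t x∈ lf))
        h∈ : h ∈ prefix v (3 * quarter)
        h∈ = through _ (subst (λ z → Walk (T*Edge S u) u z (prefix v (3 * quarter))) (sym x≡)
                                (prefix-T*-walk t ≤-refl (target-index-< t 3q≤4q)))

    branch-index-≤ : ∀ {m} → m ≤ 3 * quarter → 3 * quarter + m / 3 ≤ 4 * quarter
    branch-index-≤ {m} m≤ = begin
      3 * quarter + m / 3           ≤⟨ +-monoʳ-≤ (3 * quarter) (/-monoˡ-≤ 3 m≤) ⟩
      3 * quarter + 3 * quarter / 3 ≡⟨ cong (λ k → 3 * quarter + k / 3) (*-comm 3 quarter) ⟩
      3 * quarter + quarter * 3 / 3 ≡⟨ cong (3 * quarter +_) (m*n/n≡m quarter 3) ⟩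
      3 * quarter + quarter         ≡⟨ +-comm (3 * quarter) quarter ⟩
      4 * quarter                   ∎
      where open ≤-Reasoning

    anchorCode : ∀ {h x} → LeafAnchor h x → Fin (n * 3)
    anchorCode {h} a = combine (vertexAt branch (3 * quarter + d u h / 3)) (d u h mod 3)
      where open LeafAnchor a

    anchorCode-injective : ∀ {h x h′ x′} (a : LeafAnchor h x) (a′ : LeafAnchor h′ x′) →
                           anchorCode a ≡ anchorCode a′ → (h , x) ≡ (h′ , x′)
    anchorCode-injective {h} {x} {h′} {x′} a a′ code≡ = cong₂ _,_ h≡h′ x≡x′
      where
        open LeafAnchor a
        open LeafAnchor a′ renaming (branch to v′; branch-target to t′; ancestor-depth to ancestor-depth′;
                                     ancestor-at to ancestor-at′; leaf-at to leaf-at′)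
        v : Fin n
        v = branch
        I I′ : ℕ
        I  = 3 * quarter + d u h / 3
        I′ = 3 * quarter + d u h′ / 3
        I< : I < length (P u v)
        I< = target-index-< branch-target (branch-index-≤ ancestor-depth)
        I′< : I′ < length (P u v′)
        I′< = target-index-< t′ (branch-index-≤ ancestor-depth′)
        parts : vertexAt v I ≡ vertexAt v′ I′ × d u h mod 3 ≡ d u h′ mod 3
        parts = combine-injective (vertexAt v I) (d u h mod 3) (vertexAt v′ I′) (d u h′ mod 3) code≡
        y≡y′ : vertexAt v I ≡ vertexAt v′ I′
        y≡y′ = proj₁ parts
        third≡ : d u h / 3 ≡ d u h′ / 3
        third≡ = +-cancelˡ-≡ (3 * quarter) _ _
                   (trans (sym (d-vertexAt v I<)) (trans (cong (d u) y≡y′) (d-vertexAt v′ I′<)))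
        dh≡dh′ : d u h ≡ d u h′
        dh≡dh′ = div-mod-injective 3 third≡ (proj₂ parts)
        agree : ∀ {j} → j ≤ I → vertexAt v j ≡ vertexAt v′ j
        agree = vertexAt-agree v v′ I< (subst (λ k → 3 * quarter + k < length (P u v′)) (sym third≡) I′<)
                  (trans y≡y′ (cong (λ k → vertexAt v′ (3 * quarter + k)) (sym third≡)))
        x≡x′ : x ≡ x′
        x≡x′ = trans leaf-at (trans (agree (m≤m+n _ _)) (sym leaf-at′))
        h≡h′ : h ≡ h′
        h≡h′ = begin
          h                    ≡⟨ ancestor-at ⟩
          vertexAt v (d u h)   ≡⟨ agree (≤-trans ancestor-depth (m≤m+n _ _)) ⟩
          vertexAt v′ (d u h)  ≡⟨ cong (vertexAt v′) dh≡dh′ ⟩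
          vertexAt v′ (d u h′) ≡⟨ ancestor-at′ ⟨
          h′                   ∎
          where open ≡-Reasoning

mainTheorem16 : ∀ {n : ℕ} (S : Setting n) (u : Fin n) (hs : List (Fin n)) →
    Unique hs → All (H S u) hs → length hs * Setting.𝒟 S ≤ 3 * n
mainTheorem16 {n} S u hs hs! hs∈H = begin
  length hs * 𝒟 ≤⟨ fibrePairs-length leaves hs∈H (λ (_ , _ , _ , _ , 𝒟≤) → 𝒟≤) ⟩
  length pairs  ≤⟨ Unique-length-≤ pairs! (λ p∈ → anchorCode S u (anchor p∈))
                     (λ p∈ q∈ → anchorCode-injective S u (anchor p∈) (anchor q∈)) ⟩
  n * 3         ≡⟨ *-comm n 3 ⟩
  3 * n         ∎
  where
    open Setting S using (𝒟)
    open ≤-Reasoning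
    leaves : ∀ {h} → H S u h → List (Fin n)
    leaves (_ , ls , _) = ls
    pairs : List (Fin n × Fin n)
    pairs = fibrePairs leaves hs∈H
    pairs! : Unique pairs
    pairs! = fibrePairs-unique leaves hs∈H hs! (λ (_ , _ , ls! , _) → ls!)
    anchor : ∀ {p} → p ∈ pairs → LeafAnchor S u (proj₁ p) (proj₂ p)
    anchor p∈ = leaf-anchor S u (All.lookup (fibrePairs-All leaves hs∈H (λ (_ , _ , _ , lf , _) → lf)) p∈)
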